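{- Let $G$ be a strongly $2$-monophonic graph. Then: (i) $G$ has no cut vertices unless $G$ is isomorphic to $P_3$; (ii) for every $x\in V(G)$, the set $N[x]$ is not a cut set of $G$ (i.e., $G-N[x]$ is not disconnected); (iii) if $N(y)\subseteq N(x)$ for some distinct $x,y\in V(G)$, then $N[x]=V(G)\setminus\{y\}$; (iv) if $N[y]\subseteq N[x]$ for some distinct $x,y\in V(G)$, then $x$ is a universal vertex of $G$ (i.e., $N[x]=V(G)$).
   Context: All graphs are finite and simple. $N(v)$ is the open neighbourhood and $N[v]=N(v)\cup\{v\}$. For a graph $G$ and $u,v\in V(G)$, the monophonic interval $J_G(u,v)$ is the set of all vertices lying on some induced $u,v$-path in $G$, with the convention $u,v\in J_G(u,v)$ and $J_G(u,u)=\{u\}$. A set $S\subseteq V(G)$ is monophonic if for every $w\in V(G)$ there exist $x,y\in S$ with $w\in J_G(x,y)$; $m(G)$ is the minimum size of a monophonic set. $G$ is $2$-monophonic if $m(G)=2$, and strongly $2$-monophonic if it is $2$-monophonic and $\{x,y\}$ is a monophonic set for every pair of non-adjacent vertices $x,y$. A cut vertex (cut set) is a vertex (set) whose removal disconnects a connected graph. -}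

module Defs where

open import Data.Nat using (ℕ; zero; suc; _≤_)
open import Data.Fin using (Fin; zero; suc; toℕ; fromℕ)
open import Data.Fin.Subset using (Subset; _∈_; ∣_∣; ⁅_⁆; _∪_)
open import Data.Product using (Σ; ∃; ∃-syntax; _×_; _,_)
open import Data.Sum using (_⊎_)
open import Data.Empty using (⊥)
open import Relation.Nullary using (¬_; Dec)
open import Relation.Binary.PropositionalEquality using (_≡_; _≢_)
open import Function.Definitions using (Injective)
open import Function.Bundles using (_⇔_; _⤖_; Bijection)

record Graph : Set₁ where
  field
    n      : ℕ
    _~_    : Fin n → Fin n → Set
    ~-sym  : ∀ {u v} → u ~ v → v ~ u
    ~-irr  : ∀ {u} → ¬ (u ~ u)
    ~-dec  : ∀ u v → Dec (u ~ v)

open Graph public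

module _ (G : Graph) where
  private
    V = Fin (n G)
    _∼_ = _~_ G

  Nopen : V → V → Set
  Nopen x w = x ∼ w

  Nclosed : V → V → Set
  Nclosed x w = w ≡ x ⊎ x ∼ w

  record InducedPath (u v : V) : Set where
    field
      len   : ℕ
      vert  : Fin (suc len) → V
      inj   : Injective _≡_ _≡_ vert
      start : vert zero ≡ u
      end   : vert (fromℕ len) ≡ v
      ind   : ∀ i j → (vert i ∼ vert j) ⇔
                 (toℕ j ≡ suc (toℕ i) ⊎ toℕ i ≡ suc (toℕ j))

  J : V → V → V → Set
  J u v w = w ≡ u ⊎ w ≡ v ⊎
            Σ (InducedPath u v) (λ P → ∃[ i ] InducedPath.vert P i ≡ w)

  IsMonophonic : Subset (n G) → Set
  IsMonophonic S = ∀ w → ∃[ x ] ∃[ y ] (x ∈ S × y ∈ S × J x y w)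

  TwoMonophonic : Set
  TwoMonophonic =
    (∃[ S ] (IsMonophonic S × ∣ S ∣ ≡ 2)) ×
    (∀ S → IsMonophonic S → 2 ≤ ∣ S ∣)

  StronglyTwoMonophonic : Set
  StronglyTwoMonophonic =
    TwoMonophonic ×
    (∀ x y → x ≢ y → ¬ (x ∼ y) → IsMonophonic (⁅ x ⁆ ∪ ⁅ y ⁆))

  data Reach (S : V → Set) : V → V → Set where
    here : ∀ {u} → ¬ S u → Reach S u u
    step : ∀ {u v w} → ¬ S u → u ∼ v → Reach S v w → Reach S u w

  -- G - S is connected (vacuously if no vertex remains).
  ConnectedWithout : (V → Set) → Set
  ConnectedWithout S = ∀ u v → ¬ S u → ¬ S v → Reach S u v

  Connected : Set
  Connected = ConnectedWithout (λ _ → ⊥)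

  IsCutSet : (V → Set) → Set
  IsCutSet S = Connected × ¬ ConnectedWithout S

  IsCutVertex : V → Set
  IsCutVertex v = IsCutSet (λ w → w ≡ v)

_≅_ : Graph → Graph → Set
G ≅ H = Σ (Fin (n G) ⤖ Fin (n H)) λ f →
          ∀ u v → (_~_ G u v) ⇔ (_~_ H (Bijection.to f u) (Bijection.to f v))

data P3Adj : Fin 3 → Fin 3 → Set where
  e01 : P3Adj zero (suc zero)
  e10 : P3Adj (suc zero) zero
  e12 : P3Adj (suc zero) (suc (suc zero))
  e21 : P3Adj (suc (suc zero)) (suc zero)

private
  p3sym : ∀ {u v} → P3Adj u v → P3Adj v u
  p3sym e01 = e10
  p3sym e10 = e01
  p3sym e12 = e21
  p3sym e21 = e12

  p3irr : ∀ {u} → ¬ P3Adj u u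
  p3irr ()

  open import Relation.Nullary using (yes; no)
  p3dec : ∀ u v → Dec (P3Adj u v)
  p3dec zero zero = no λ ()
  p3dec zero (suc zero) = yes e01
  p3dec zero (suc (suc zero)) = no λ ()
  p3dec (suc zero) zero = yes e10
  p3dec (suc zero) (suc zero) = no λ ()
  p3dec (suc zero) (suc (suc zero)) = yes e12
  p3dec (suc (suc zero)) zero = no λ ()
  p3dec (suc (suc zero)) (suc zero) = yes e21
  p3dec (suc (suc zero)) (suc (suc zero)) = no λ ()

P₃ : Graph
P₃ = record { n = 3 ; _~_ = P3Adj ; ~-sym = p3sym ; ~-irr = p3irr ; ~-dec = p3dec }

-- On an induced path
-- starting at x, N[x] consists exactly of positions 0 and 1, and a vertex
-- adjacent to both ends sits at position 1 of a path of length 2.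
--  (i)   For neighbours a, b of a cut vertex v, an induced a–b path through a
--        vertex outside {a, v, b} misses v. So either V = {a, v, b} with a, b
--        non-adjacent, i.e. G ≅ P₃, or any two neighbours of v are joined in
--        G − v and every walk can be rerouted around v.
--  (ii)  For u, v ∉ N[x], u lies at position ≥ 2 of an induced x–v path, and
--        the rest of that path stays at positions ≥ 2, outside N[x].
--  (iii) Here x ≁ y, and the predecessor of y on an induced x–y path is
--        adjacent to y, hence to x; so the path has length 2 and every w ≠ y
--        is at position ≤ 1, in N[x].
--  (iv)  If w ∉ N[x], y lies on an induced x–w path; an inner vertex of an
--        induced path has its successor at position ≥ 2, outside N[x], so
--        N[y] ⊈ N[x].
module Submission where

open import Defs
open import Data.Fin using (Fin)
open import Data.Product using (∃-syntax; _×_)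
open import Relation.Nullary using (¬_)
open import Relation.Binary.PropositionalEquality using (_≡_; _≢_)
open import Function.Bundles using (_⇔_)

open import Data.Nat using (suc; _∸_; _≤_; _<_; z≤n; s≤s; s≤s⁻¹; >-nonZero)
open import Data.Nat.Properties
  using (≤-refl; ≤-trans; ≤-reflexive; ≤-antisym; n≤1+n; 1+n≰n; ≤∧≢⇒<; n≢0⇒n>0; n≤0⇒n≡0; +-∸-assoc; pred[n]≤n; suc-pred)
open import Data.Fin using (zero; suc; toℕ; fromℕ; fromℕ<; inject₁; opposite)
open import Data.Fin.Properties
  using (toℕ-injective; toℕ-fromℕ; toℕ-fromℕ<; toℕ-inject₁; toℕ≤pred[n]; opposite-prop;
         opposite-involutive; _≟_; any?; all?; ¬∀⟶∃¬)
open import Data.Fin.Induction using (>-weakInduction)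
open import Data.Fin.Subset using (_∈_; ⁅_⁆; _∪_)
open import Data.Fin.Subset.Properties using (x∈p∪q⁻; x∈⁅y⁆⇒x≡y)
open import Data.Product using (_,_; Σ-syntax)
open import Data.Sum using (_⊎_; inj₁; inj₂)
import Data.Sum as Sum
open import Data.Empty using (⊥; ⊥-elim)
open import Relation.Nullary using (Dec; yes; no)
open import Relation.Nullary.Decidable using (_⊎-dec_; _×-dec_; ¬?)
open import Relation.Binary.PropositionalEquality using (refl; sym; trans; cong; subst; subst₂; module ≡-Reasoning)
open import Function using (_∘_)
open import Function.Bundles using (mk⇔; mk↔ₛ′; Equivalence)
open import Function.Properties.Inverse using (↔⇒⤖)

Consecutive : ∀ {m} → Fin m → Fin m → Set
Consecutive i j = toℕ j ≡ suc (toℕ i) ⊎ toℕ i ≡ suc (toℕ j)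

opposite-suc≡suc-opposite : ∀ {m} {i j : Fin m} →
  toℕ j ≡ suc (toℕ i) → toℕ (opposite i) ≡ suc (toℕ (opposite j))
opposite-suc≡suc-opposite {suc L} {i} {j} j≡1+i = begin
  toℕ (opposite i)           ≡⟨ opposite-prop i ⟩
  L ∸ toℕ i                  ≡⟨ +-∸-assoc 1 (subst (_≤ L) j≡1+i (toℕ≤pred[n] j)) ⟩
  suc (L ∸ suc (toℕ i))      ≡⟨ cong (λ k → suc (L ∸ k)) (sym j≡1+i) ⟩
  suc (L ∸ toℕ j)            ≡⟨ cong suc (opposite-prop j) ⟨
  suc (toℕ (opposite j))     ∎
  where open ≡-Reasoning

opposite-Consecutive : ∀ {m} {i j : Fin m} → Consecutive i j → Consecutive (opposite i) (opposite j)
opposite-Consecutive (inj₁ j≡1+i) = inj₂ (opposite-suc≡suc-opposite j≡1+i)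
opposite-Consecutive (inj₂ i≡1+j) = inj₁ (opposite-suc≡suc-opposite i≡1+j)

opposite-Consecutive⁻ : ∀ {m} {i j : Fin m} → Consecutive (opposite i) (opposite j) → Consecutive i j
opposite-Consecutive⁻ {i = i} {j} c =
  subst₂ Consecutive (opposite-involutive i) (opposite-involutive j) (opposite-Consecutive c)

x∈⁅y⁆∪⁅z⁆⇒x≡y⊎x≡z : ∀ {m} {x y z : Fin m} → x ∈ ⁅ y ⁆ ∪ ⁅ z ⁆ → x ≡ y ⊎ x ≡ z
x∈⁅y⁆∪⁅z⁆⇒x≡y⊎x≡z {y = y} {z} x∈ = Sum.map (x∈⁅y⁆⇒x≡y y) (x∈⁅y⁆⇒x≡y z) (x∈p∪q⁻ ⁅ y ⁆ ⁅ z ⁆ x∈)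

module _ (G : Graph) where
  private
    V : Set
    V = Fin (n G)

    _∼_ : V → V → Set
    _∼_ = _~_ G

  ∼⇒≢ : ∀ {a b} → a ∼ b → a ≢ b
  ∼⇒≢ a∼a refl = ~-irr G a∼a

  Nclosed? : ∀ x w → Dec (Nclosed G x w)
  Nclosed? x w = (w ≟ x) ⊎-dec (~-dec G x w)

  Reach-trans : ∀ {S u v w} → Reach G S u v → Reach G S v w → Reach G S u w
  Reach-trans (here _)           r′ = r′
  Reach-trans (step u∉S u∼u′ r) r′ = step u∉S u∼u′ (Reach-trans r r′)

  reverse : ∀ {u v} → InducedPath G u v → InducedPath G v u
  reverse P = record
    { len   = len
    ; vert  = λ i → vert (opposite i)
    ; inj   = λ {i} {j} e → trans (sym (opposite-involutive i))
                (trans (cong opposite (inj e)) (opposite-involutive j))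
    ; start = end
    ; end   = trans (cong vert (opposite-involutive zero)) start
    ; ind   = λ i j → mk⇔ (λ a → opposite-Consecutive⁻ (Equivalence.to (ind (opposite i) (opposite j)) a))
                          (λ c → Equivalence.from (ind (opposite i) (opposite j)) (opposite-Consecutive c))
    }
    where open InducedPath P

  J-sym : ∀ {a b w} → J G a b w → J G b a w
  J-sym (inj₁ w≡a)                = inj₂ (inj₁ w≡a)
  J-sym (inj₂ (inj₁ w≡b))         = inj₁ w≡b
  J-sym (inj₂ (inj₂ (P , i , e))) =
    inj₂ (inj₂ (reverse P , opposite i , trans (cong (InducedPath.vert P) (opposite-involutive i)) e))

  ∈J[a,a]⇒≡a : ∀ {a w} → J G a a w → w ≡ a
  ∈J[a,a]⇒≡a (inj₁ w≡a)                = w≡a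
  ∈J[a,a]⇒≡a (inj₂ (inj₁ w≡a))         = w≡a
  ∈J[a,a]⇒≡a (inj₂ (inj₂ (P , i , e))) = trans (sym e) (trans (cong vert i≡0) start)
    where
    open InducedPath P
    len≡0 : len ≡ 0
    len≡0 = trans (sym (toℕ-fromℕ len)) (cong toℕ (sym (inj (trans start (sym end)))))
    i≡0 : i ≡ zero
    i≡0 = toℕ-injective (≤-antisym (subst (toℕ i ≤_) len≡0 (toℕ≤pred[n] i)) z≤n)

  NonAdjacentPairsMonophonic : Set
  NonAdjacentPairsMonophonic = ∀ x y → x ≢ y → ¬ x ∼ y → ∀ w → J G x y w

  strongly2Monophonic⇒nonAdjacentPairsMonophonic :
    StronglyTwoMonophonic G → NonAdjacentPairsMonophonic
  strongly2Monophonic⇒nonAdjacentPairsMonophonic (_ , pairs) x y x≢y x≁y w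
    with pairs x y x≢y x≁y w
  ... | p , q , p∈ , q∈ , w∈J with x∈⁅y⁆∪⁅z⁆⇒x≡y⊎x≡z p∈ | x∈⁅y⁆∪⁅z⁆⇒x≡y⊎x≡z q∈
  ... | inj₁ refl | inj₁ refl = inj₁ (∈J[a,a]⇒≡a w∈J)
  ... | inj₁ refl | inj₂ refl = w∈J
  ... | inj₂ refl | inj₁ refl = J-sym w∈J
  ... | inj₂ refl | inj₂ refl = inj₂ (inj₁ (∈J[a,a]⇒≡a w∈J))

  module InducedPathProperties {u v : V} (P : InducedPath G u v) where
    open InducedPath P

    consecutive⇒adjacent : ∀ {i j} → toℕ j ≡ suc (toℕ i) → vert i ∼ vert j
    consecutive⇒adjacent j≡1+i = Equivalence.from (ind _ _) (inj₁ j≡1+i)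

    position0⇒start : ∀ {i} → toℕ i ≡ 0 → vert i ≡ u
    position0⇒start i≡0 = trans (cong vert (toℕ-injective i≡0)) start

    start⇒position0 : ∀ {i} → vert i ≡ u → toℕ i ≡ 0
    start⇒position0 i≡u = cong toℕ (inj (trans i≡u (sym start)))

    start-adjacent⇒position1 : ∀ {j} → u ∼ vert j → toℕ j ≡ 1
    start-adjacent⇒position1 {j} u∼j
      with Equivalence.to (ind zero j) (subst (_∼ vert j) (sym start) u∼j)
    ... | inj₁ j≡1 = j≡1

    ∈N[start]⇒position≤1 : ∀ {j} → Nclosed G u (vert j) → toℕ j ≤ 1
    ∈N[start]⇒position≤1 (inj₁ j≡u) = ≤-trans (≤-reflexive (start⇒position0 j≡u)) z≤n
    ∈N[start]⇒position≤1 (inj₂ u∼j) = ≤-reflexive (start-adjacent⇒position1 u∼j)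

    position≤1⇒∈N[start] : ∀ {j} → toℕ j ≤ 1 → Nclosed G u (vert j)
    position≤1⇒∈N[start] {j} j≤1 with toℕ j in e | j≤1
    ... | 0 | _ = inj₁ (position0⇒start e)
    ... | 1 | _ = inj₂ (subst (_∼ vert j) start (consecutive⇒adjacent {zero} e))
    ... | suc (suc _) | s≤s ()

    end-adjacent⇒predecessor : ∀ {j} → vert j ∼ v → suc (toℕ j) ≡ len
    end-adjacent⇒predecessor {j} j∼v
      with Equivalence.to (ind j (fromℕ len)) (subst (vert j ∼_) (sym end) j∼v)
    ... | inj₁ e = trans (sym e) (toℕ-fromℕ len)
    ... | inj₂ e = ⊥-elim (1+n≰n (subst (_≤ len) (trans e (cong suc (toℕ-fromℕ len))) (toℕ≤pred[n] j)))

    ≢end⇒position<len : ∀ {i} → vert i ≢ v → toℕ i < len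
    ≢end⇒position<len {i} i≢v = ≤∧≢⇒< (toℕ≤pred[n] i) λ i≡len →
      i≢v (trans (cong vert (toℕ-injective (trans i≡len (sym (toℕ-fromℕ len))))) end)

    successor : ∀ {i : Fin (suc len)} → toℕ i < len → Σ[ j ∈ Fin (suc len) ] toℕ j ≡ suc (toℕ i)
    successor i<len = fromℕ< (s≤s i<len) , toℕ-fromℕ< (s≤s i<len)

    predecessor-of-end : u ≢ v → Σ[ j ∈ Fin (suc len) ] suc (toℕ j) ≡ len × vert j ∼ v
    predecessor-of-end u≢v =
      j , j+1≡len , subst (vert j ∼_) end (consecutive⇒adjacent (trans (toℕ-fromℕ len) (sym j+1≡len)))
      where
      0<len : 0 < len
      0<len = ≢end⇒position<len {zero} (λ 0≡v → u≢v (trans (sym start) 0≡v))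
      j : Fin (suc len)
      j = fromℕ< (s≤s (pred[n]≤n {len}))
      j+1≡len : suc (toℕ j) ≡ len
      j+1≡len = trans (cong suc (toℕ-fromℕ< (s≤s (pred[n]≤n {len})))) (suc-pred len {{>-nonZero 0<len}})

    segment-reach : ∀ {S} i → (∀ j → toℕ i ≤ toℕ j → ¬ S (vert j)) → Reach G S (vert i) v
    segment-reach {S} = >-weakInduction Segment last extend
      where
      Segment : Fin (suc len) → Set
      Segment i = (∀ j → toℕ i ≤ toℕ j → ¬ S (vert j)) → Reach G S (vert i) v
      last : Segment (fromℕ len)
      last avoid = subst (Reach G S _) end (here (avoid (fromℕ len) ≤-refl))
      extend : ∀ i → Segment (suc i) → Segment (inject₁ i)
      extend i reach avoid =
        step (avoid (inject₁ i) ≤-refl)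
             (consecutive⇒adjacent (cong suc (sym (toℕ-inject₁ i))))
             (reach λ j 1+i≤j → avoid j (≤-trans (≤-trans (≤-reflexive (toℕ-inject₁ i)) (n≤1+n _)) 1+i≤j))

    path-reach : ∀ {S} → (∀ i → ¬ S (vert i)) → Reach G S u v
    path-reach avoid = subst (λ s → Reach G _ s v) start (segment-reach zero λ j _ → avoid j)

    ∉N[start]⇒reach-end : ∀ {i} → ¬ Nclosed G u (vert i) → Reach G (Nclosed G u) (vert i) v
    ∉N[start]⇒reach-end {i} i∉N[u] = segment-reach i λ j i≤j j∈N[u] →
      i∉N[u] (position≤1⇒∈N[start] (≤-trans i≤j (∈N[start]⇒position≤1 j∈N[u])))

    Nopen-end⊆Nopen-start⇒∈N[start] : u ≢ v → (∀ w → v ∼ w → u ∼ w) →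
      ∀ i → vert i ≢ v → Nclosed G u (vert i)
    Nopen-end⊆Nopen-start⇒∈N[start] u≢v N⊆ i i≢v with predecessor-of-end u≢v
    ... | j , j+1≡len , j∼v =
      position≤1⇒∈N[start] (s≤s⁻¹ (subst (toℕ i <_) len≡2 (≢end⇒position<len i≢v)))
      where
      len≡2 : len ≡ 2
      len≡2 = trans (sym j+1≡len) (cong suc (start-adjacent⇒position1 (N⊆ (vert j) (~-sym G j∼v))))

    Nclosed⊆N[start]⇒endpoint : ∀ i → (∀ w → Nclosed G (vert i) w → Nclosed G u w) →
      vert i ≡ u ⊎ vert i ≡ v
    Nclosed⊆N[start]⇒endpoint i N⊆ with vert i ≟ v
    ... | yes i≡v = inj₂ i≡v
    ... | no i≢v with successor (≢end⇒position<len i≢v)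
    ...   | j , j≡1+i = inj₁ (position0⇒start (n≤0⇒n≡0 (s≤s⁻¹ (subst (_≤ 1) j≡1+i j≤1))))
      where
      j≤1 : toℕ j ≤ 1
      j≤1 = ∈N[start]⇒position≤1 (N⊆ (vert j) (inj₂ (consecutive⇒adjacent j≡1+i)))

    through-common-neighbour : ∀ {c j} → u ∼ c → c ∼ v → vert j ≡ c →
      ∀ i → vert i ≡ u ⊎ vert i ≡ c ⊎ vert i ≡ v
    through-common-neighbour {c} {j} u∼c c∼v j≡c i with vert i ≟ u | vert i ≟ v
    ... | yes i≡u | _       = inj₁ i≡u
    ... | no _    | yes i≡v = inj₂ (inj₂ i≡v)
    ... | no i≢u  | no i≢v  = inj₂ (inj₁ (trans (cong vert (toℕ-injective (trans i≡1 (sym j≡1)))) j≡c))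
      where
      j≡1 : toℕ j ≡ 1
      j≡1 = start-adjacent⇒position1 (subst (u ∼_) (sym j≡c) u∼c)
      len≡2 : len ≡ 2
      len≡2 = trans (sym (end-adjacent⇒predecessor (subst (_∼ v) (sym j≡c) c∼v))) (cong suc j≡1)
      i≡1 : toℕ i ≡ 1
      i≡1 = ≤-antisym (s≤s⁻¹ (subst (toℕ i <_) len≡2 (≢end⇒position<len i≢v)))
                      (n≢0⇒n>0 (λ i≡0 → i≢u (position0⇒start i≡0)))

  module _ (pairs : NonAdjacentPairsMonophonic) where

    connectedWithout-Nclosed : ∀ x → ConnectedWithout G (Nclosed G x)
    connectedWithout-Nclosed x u v u∉N[x] v∉N[x]
      with pairs x v (λ x≡v → v∉N[x] (inj₁ (sym x≡v))) (λ x∼v → v∉N[x] (inj₂ x∼v)) u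
    ... | inj₁ u≡x                   = ⊥-elim (u∉N[x] (inj₁ u≡x))
    ... | inj₂ (inj₁ refl)           = here u∉N[x]
    ... | inj₂ (inj₂ (P , i , refl)) = InducedPathProperties.∉N[start]⇒reach-end P u∉N[x]

    Nopen⊆⇒Nclosed≡complement : ∀ x y → x ≢ y → (∀ w → Nopen G y w → Nopen G x w) →
      ∀ w → Nclosed G x w ⇔ (w ≢ y)
    Nopen⊆⇒Nclosed≡complement x y x≢y N⊆ w = mk⇔ ∈N[x]⇒≢y ≢y⇒∈N[x]
      where
      x≁y : ¬ x ∼ y
      x≁y x∼y = ~-irr G (N⊆ x (~-sym G x∼y))

      ∈N[x]⇒≢y : Nclosed G x w → w ≢ y
      ∈N[x]⇒≢y (inj₁ w≡x) w≡y = x≢y (trans (sym w≡x) w≡y)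
      ∈N[x]⇒≢y (inj₂ x∼w) refl = x≁y x∼w

      ≢y⇒∈N[x] : w ≢ y → Nclosed G x w
      ≢y⇒∈N[x] w≢y with pairs x y x≢y x≁y w
      ... | inj₁ w≡x                   = inj₁ w≡x
      ... | inj₂ (inj₁ w≡y)            = ⊥-elim (w≢y w≡y)
      ... | inj₂ (inj₂ (P , i , refl)) =
        InducedPathProperties.Nopen-end⊆Nopen-start⇒∈N[start] P x≢y N⊆ i w≢y

    Nclosed⊆⇒universal : ∀ x y → x ≢ y → (∀ w → Nclosed G y w → Nclosed G x w) →
      ∀ w → Nclosed G x w
    Nclosed⊆⇒universal x y x≢y N⊆ w with Nclosed? x w
    ... | yes w∈N[x] = w∈N[x]
    ... | no w∉N[x] = ⊥-elim (y∉J (pairs x w (λ x≡w → w∉N[x] (inj₁ (sym x≡w))) (λ x∼w → w∉N[x] (inj₂ x∼w)) y))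
      where
      y≢w : y ≢ w
      y≢w refl with N⊆ y (inj₁ refl)
      ... | inj₁ y≡x = x≢y (sym y≡x)
      ... | inj₂ x∼y = w∉N[x] (inj₂ x∼y)

      y∉J : ¬ J G x w y
      y∉J (inj₁ y≡x)                  = x≢y (sym y≡x)
      y∉J (inj₂ (inj₁ y≡w))           = y≢w y≡w
      y∉J (inj₂ (inj₂ (P , i , refl)))
        with InducedPathProperties.Nclosed⊆N[start]⇒endpoint P i N⊆
      ... | inj₁ y≡x = x≢y (sym y≡x)
      ... | inj₂ y≡w = y≢w y≡w

  P₃Configuration : V → V → V → Set
  P₃Configuration v a b = a ∼ v × b ∼ v × a ≢ b × ¬ a ∼ b × (∀ w → w ≡ a ⊎ w ≡ v ⊎ w ≡ b)

  P₃Configuration? : ∀ v a b → Dec (P₃Configuration v a b)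
  P₃Configuration? v a b =
    ~-dec G a v ×-dec ~-dec G b v ×-dec ¬? (a ≟ b) ×-dec ¬? (~-dec G a b) ×-dec
    all? (λ w → w ≟ a ⊎-dec w ≟ v ⊎-dec w ≟ b)

  P₃Configuration⇒≅P₃ : ∀ {v a b} → P₃Configuration v a b → G ≅ P₃
  P₃Configuration⇒≅P₃ {v} {a} {b} (a∼v , b∼v , a≢b , a≁b , cover) =
    ↔⇒⤖ (mk↔ₛ′ position vertex position-vertex vertex-position) , adjacency
    where
    vertex : Fin 3 → V
    vertex zero             = a
    vertex (suc zero)       = v
    vertex (suc (suc zero)) = b

    position : V → Fin 3
    position w with cover w
    ... | inj₁ _        = zero
    ... | inj₂ (inj₁ _) = suc zero
    ... | inj₂ (inj₂ _) = suc (suc zero)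

    vertex-position : ∀ w → vertex (position w) ≡ w
    vertex-position w with cover w
    ... | inj₁ w≡a        = sym w≡a
    ... | inj₂ (inj₁ w≡v) = sym w≡v
    ... | inj₂ (inj₂ w≡b) = sym w≡b

    vertex-injective : ∀ {i j} → vertex i ≡ vertex j → i ≡ j
    vertex-injective {zero}             {zero}             _   = refl
    vertex-injective {zero}             {suc zero}         a≡v = ⊥-elim (∼⇒≢ a∼v a≡v)
    vertex-injective {zero}             {suc (suc zero)}   a≡b = ⊥-elim (a≢b a≡b)
    vertex-injective {suc zero}         {zero}             v≡a = ⊥-elim (∼⇒≢ a∼v (sym v≡a))
    vertex-injective {suc zero}         {suc zero}         _   = refl
    vertex-injective {suc zero}         {suc (suc zero)}   v≡b = ⊥-elim (∼⇒≢ b∼v (sym v≡b))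
    vertex-injective {suc (suc zero)}   {zero}             b≡a = ⊥-elim (a≢b (sym b≡a))
    vertex-injective {suc (suc zero)}   {suc zero}         b≡v = ⊥-elim (∼⇒≢ b∼v b≡v)
    vertex-injective {suc (suc zero)}   {suc (suc zero)}   _   = refl

    position-vertex : ∀ i → position (vertex i) ≡ i
    position-vertex i = vertex-injective (vertex-position (vertex i))

    vertex-adjacency : ∀ i j → vertex i ∼ vertex j ⇔ P3Adj i j
    vertex-adjacency zero             zero             = mk⇔ (λ a∼a → ⊥-elim (~-irr G a∼a)) λ ()
    vertex-adjacency zero             (suc zero)       = mk⇔ (λ _ → e01) (λ _ → a∼v)
    vertex-adjacency zero             (suc (suc zero)) = mk⇔ (λ a∼b → ⊥-elim (a≁b a∼b)) λ ()
    vertex-adjacency (suc zero)       zero             = mk⇔ (λ _ → e10) (λ _ → ~-sym G a∼v)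
    vertex-adjacency (suc zero)       (suc zero)       = mk⇔ (λ v∼v → ⊥-elim (~-irr G v∼v)) λ ()
    vertex-adjacency (suc zero)       (suc (suc zero)) = mk⇔ (λ _ → e12) (λ _ → ~-sym G b∼v)
    vertex-adjacency (suc (suc zero)) zero             = mk⇔ (λ b∼a → ⊥-elim (a≁b (~-sym G b∼a))) λ ()
    vertex-adjacency (suc (suc zero)) (suc zero)       = mk⇔ (λ _ → e21) (λ _ → b∼v)
    vertex-adjacency (suc (suc zero)) (suc (suc zero)) = mk⇔ (λ b∼b → ⊥-elim (~-irr G b∼b)) λ ()

    adjacency : ∀ u w → u ∼ w ⇔ P3Adj (position u) (position w)
    adjacency u w = mk⇔
      (λ u∼w → Equivalence.to (vertex-adjacency (position u) (position w))
                 (subst₂ _∼_ (sym (vertex-position u)) (sym (vertex-position w)) u∼w))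
      (λ p → subst₂ _∼_ (vertex-position u) (vertex-position w)
                 (Equivalence.from (vertex-adjacency (position u) (position w)) p))

  module _ {v : V} (linked : ∀ {a b} → a ∼ v → b ∼ v → Reach G (_≡ v) a b) where
    mutual
      reroute : ∀ {u w} → u ≢ v → w ≢ v → Reach G (λ _ → ⊥) u w → Reach G (_≡ v) u w
      reroute u≢v w≢v (here _) = here u≢v
      reroute u≢v w≢v (step {v = u′} _ u∼u′ r) with u′ ≟ v
      ... | no u′≢v = step u≢v u∼u′ (reroute u′≢v w≢v r)
      ... | yes refl = detour u∼u′ w≢v r

      detour : ∀ {a w} → a ∼ v → w ≢ v → Reach G (λ _ → ⊥) v w → Reach G (_≡ v) a w
      detour a∼v w≢v (here _)       = ⊥-elim (w≢v refl)
      detour a∼v w≢v (step _ v∼b r) =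
        Reach-trans (linked a∼v (~-sym G v∼b)) (reroute (∼⇒≢ v∼b ∘ sym) w≢v r)

    linked⇒connectedWithout : Connected G → ConnectedWithout G (_≡ v)
    linked⇒connectedWithout connected u w u≢v w≢v = reroute u≢v w≢v (connected u w (λ ()) (λ ()))

  module _ (pairs : NonAdjacentPairsMonophonic) {v : V}
           (no-P₃ : ∀ a b → ¬ P₃Configuration v a b) where

    common-neighbours-linked : ∀ {a b} → a ∼ v → b ∼ v → Reach G (_≡ v) a b
    common-neighbours-linked {a} {b} a∼v b∼v with a ≟ b | ~-dec G a b
    ... | yes refl | _       = here (∼⇒≢ a∼v)
    ... | no _     | yes a∼b = step (∼⇒≢ a∼v) a∼b (here (∼⇒≢ b∼v))
    ... | no a≢b   | no a≁b
      with ¬∀⟶∃¬ (n G) _ (λ w → w ≟ a ⊎-dec w ≟ v ⊎-dec w ≟ b)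
                 (λ cover → no-P₃ a b (a∼v , b∼v , a≢b , a≁b , cover))
    ...   | w , w∉ with pairs a b a≢b a≁b w
    ...     | inj₁ w≡a                   = ⊥-elim (w∉ (inj₁ w≡a))
    ...     | inj₂ (inj₁ w≡b)            = ⊥-elim (w∉ (inj₂ (inj₂ w≡b)))
    ...     | inj₂ (inj₂ (P , i , refl)) = InducedPathProperties.path-reach P λ j j≡v →
      w∉ (InducedPathProperties.through-common-neighbour P a∼v (~-sym G b∼v) j≡v i)

  cutVertex⇒≅P₃ : NonAdjacentPairsMonophonic → ∀ {v} → IsCutVertex G v → G ≅ P₃
  cutVertex⇒≅P₃ pairs {v} (connected , disconnected)
    with any? (λ a → any? (P₃Configuration? v a))
  ... | yes (a , b , config) = P₃Configuration⇒≅P₃ config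
  ... | no ¬config = ⊥-elim (disconnected (linked⇒connectedWithout
          (common-neighbours-linked pairs λ a b config → ¬config (a , b , config)) connected))

proposition3p2 : (G : Graph) → StronglyTwoMonophonic G →
    (((∃[ v ] IsCutVertex G v) → G ≅ P₃)
    × (∀ x → ¬ IsCutSet G (Nclosed G x))
    × (∀ x y → x ≢ y → (∀ w → Nopen G y w → Nopen G x w) →
         ∀ w → Nclosed G x w ⇔ (w ≢ y))
    × (∀ x y → x ≢ y → (∀ w → Nclosed G y w → Nclosed G x w) →
         ∀ w → Nclosed G x w))
proposition3p2 G strongly =
  (λ (_ , cut) → cutVertex⇒≅P₃ G pairs cut) ,
  (λ x (_ , disconnected) → disconnected (connectedWithout-Nclosed G pairs x)) ,
  Nopen⊆⇒Nclosed≡complement G pairs ,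
  Nclosed⊆⇒universal G pairs
  where
  pairs : NonAdjacentPairsMonophonic G
  pairs = strongly2Monophonic⇒nonAdjacentPairsMonophonic G strongly
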